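{- Suppose $G = K_{n_1, \ldots, n_t}$ with $t, n_1, \ldots, n_t \in \mathbb{N}$ and $t \geq 2$, and let $s = \sum_{i=1}^t \lceil n_i/2 \rceil$. Then $G$ is not proportionally $(s-1)$-choosable. Consequently, $\chi_{pc}(K_{n_1,\ldots,n_t}) \geq \sum_{i=1}^t \lceil n_i/2 \rceil$.
   Context: All graphs are finite and simple; $\mathbb{N}=\{1,2,3,\ldots\}$. $K_{n_1,\ldots,n_t}$ denotes the complete $t$-partite graph with partite sets of sizes $n_1,\ldots,n_t$. A list assignment $L$ for a graph $G$ assigns to each vertex $v$ a set $L(v)$ of colors; it is a $k$-assignment if $|L(v)|=k$ for all $v$. The palette is $\mathcal{L}=\bigcup_{v}L(v)$. A proper $L$-coloring is a proper coloring $f$ with $f(v)\in L(v)$ for all $v$. For $c\in\mathcal{L}$, $\eta(c)$ is the number of vertices $v$ with $c\in L(v)$. If $L$ is a $k$-assignment, a proper $L$-coloring $f$ is a proportional $L$-coloring if for every $c\in\mathcal{L}$, $|f^{ -1}(c)|\in\{\lfloor \eta(c)/k\rfloor,\lceil \eta(c)/k\rceil\}$. $G$ is proportionally $k$-choosable if it has a proportional $L$-coloring for every $k$-assignment $L$; $\chi_{pc}(G)$ is the smallest $k$ such that $G$ is proportionally $k$-choosable. -}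

module Defs where

open import Data.Nat using (ℕ; zero; suc; _+_; _≤_; _∸_; _/_)
open import Data.Nat.Properties using (_≟_)
open import Data.Fin using (Fin)
open import Data.List using (List; length; filter; map; concatMap; allFin; tabulate)
open import Data.Nat.ListAction using (sum)
open import Data.List.Relation.Unary.Unique.Propositional using (Unique)
open import Data.List.Membership.Propositional using (_∈_)
open import Data.List.Membership.DecPropositional _≟_ using (_∈?_)
open import Data.Product using (Σ; _,_; proj₁; _×_)
open import Relation.Binary.PropositionalEquality using (_≡_; _≢_)
open import Relation.Nullary using (¬_)

-- A finite simple graph, presented by a duplicate-free complete list of its
-- vertices and an adjacency relation (symmetric and irreflexive).
record Graph : Set₁ where
  field
    Vertex   : Set
    vertices : List Vertex
    Adj      : Vertex → Vertex → Set

open Graph public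

Colour : Set
Colour = ℕ

ListAssignment : Graph → Set
ListAssignment G = Vertex G → List Colour

IsKAssignment : (G : Graph) → ℕ → ListAssignment G → Set
IsKAssignment G k L = ∀ v → Unique (L v) × length (L v) ≡ k

η : (G : Graph) → ListAssignment G → Colour → ℕ
η G L c = length (filter (λ v → c ∈? L v) (vertices G))

preimageSize : (G : Graph) → (Vertex G → Colour) → Colour → ℕ
preimageSize G f c = length (filter (λ v → f v ≟ c) (vertices G))

IsProperLColouring : (G : Graph) → ListAssignment G → (Vertex G → Colour) → Set
IsProperLColouring G L f =
  (∀ v → f v ∈ L v) × (∀ u v → Adj G u v → f u ≢ f v)

floorDiv : ℕ → ℕ → ℕ
floorDiv a zero    = 0
floorDiv a (suc k) = a / suc k

ceilDiv : ℕ → ℕ → ℕ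
ceilDiv a zero    = 0
ceilDiv a (suc k) = (a + k) / suc k

InPalette : (G : Graph) → ListAssignment G → Colour → Set
InPalette G L c = Σ (Vertex G) (λ v → c ∈ L v)

IsProportionalLColouring : (G : Graph) → ℕ → ListAssignment G → (Vertex G → Colour) → Set
IsProportionalLColouring G k L f =
  IsProperLColouring G L f ×
  (∀ c → InPalette G L c →
     (preimageSize G f c ≡ floorDiv (η G L c) k) Data.Sum.⊎ (preimageSize G f c ≡ ceilDiv (η G L c) k))
  where import Data.Sum

ProportionallyChoosable : Graph → ℕ → Set
ProportionallyChoosable G k =
  (L : ListAssignment G) → IsKAssignment G k L →
  Σ (Vertex G → Colour) (λ f → IsProportionalLColouring G k L f)

completeMultipartite : (t : ℕ) → (Fin t → ℕ) → Graph
completeMultipartite t n = record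
  { Vertex   = Σ (Fin t) (λ i → Fin (n i))
  ; vertices = concatMap (λ i → map (λ j → (i , j)) (allFin (n i))) (allFin t)
  ; Adj      = λ u v → proj₁ u ≢ proj₁ v
  }

ceilHalf : ℕ → ℕ
ceilHalf m = ceilDiv m 2

sumCeilHalves : (t : ℕ) → (Fin t → ℕ) → ℕ
sumCeilHalves t n = sum (tabulate {n = t} (λ i → ceilHalf (n i)))

module Submission where

-- Idea (for 1 ≤ K < s).  Pick mᵢ ≤ nᵢ with Σᵢ ⌈mᵢ/2⌉ = K + 1 and Σᵢ mᵢ ≤ 2K
-- (take mᵢ odd, spreading over at least two parts).  Give the first mᵢ
-- vertices of part i the list A = {0,…,K−1} and every other vertex the list
-- B = {K,…,2K−1}.  Each colour c ∈ A then has η(c) ≤ Σ mᵢ ≤ 2K, so a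
-- proportional colouring uses c at most ⌈η(c)/K⌉ ≤ 2 times, and properness
-- keeps all uses of c inside one part.  Writing uᵢ(c) for the uses of c in
-- part i, the A-vertices of part i give mᵢ ≤ Σ_{c∈A} uᵢ(c), whence
--   K + 1 = Σᵢ ⌈mᵢ/2⌉ ≤ Σᵢ Σ_c ⌈uᵢ(c)/2⌉ = Σ_c Σᵢ ⌈uᵢ(c)/2⌉ ≤ Σ_c 1 = K,
-- a contradiction.  The case K = 0 is trivial (empty lists).

open import Defs
open import Data.Bool using (Bool; true; false; T)
open import Data.Empty using (⊥-elim)
open import Data.Fin as Fin using (Fin; toℕ; fromℕ<)
open import Data.Fin.Properties using (any?; toℕ-fromℕ<; toℕ<n)
  renaming (suc-injective to Fin-suc-injective)
open import Data.List using (List; []; _∷_; _++_; map; concatMap; allFin; tabulate; upTo; length; filter)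
open import Data.List.Properties using (length-map; length-upTo)
open import Data.List.Membership.Propositional using (_∈_)
open import Data.List.Membership.Propositional.Properties using (∈-upTo⁻; ∈-map⁻)
open import Data.List.Relation.Unary.AllPairs using ([])
open import Data.List.Relation.Unary.Unique.Propositional using (Unique)
import Data.List.Relation.Unary.Unique.Propositional.Properties as Unique
open import Data.Nat using (ℕ; zero; suc; _+_; _*_; _∸_; _≤_; _<_; _⊓_; z≤n; s≤s; _<ᵇ_; _≤?_; _<?_)
open import Data.Nat.Properties
open import Algebra.Properties.CommutativeMonoid.Sum +-0-commutativeMonoid
  using (sum-syntax; ∑-comm; sum-cong-≗)
open import Data.List.Membership.DecPropositional _≟_ using (_∈?_)
open import Data.Nat.DivMod using (m/n≡1+[m∸n]/n; /-monoˡ-≤; m<n*o⇒m/o<n)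
import Data.Nat.ListAction as List
open import Data.Nat.Tactic.RingSolver using (solve-∀)
open import Data.Product using (∃; _×_; _,_; proj₁; proj₂)
open import Data.Sum using (_⊎_; inj₁; inj₂)
open import Function using (_∘_)
open import Relation.Binary.PropositionalEquality
open import Relation.Nullary using (¬_; Dec; yes; no; does)
open import Relation.Unary using (Decidable)

yes-witness : {P : Set} (d : Dec P) → T (does d) → P
yes-witness (yes p) _ = p

witness-yes : {P : Set} (d : Dec P) → P → T (does d)
witness-yes (yes _) _ = _
witness-yes (no ¬p) p = ¬p p

𝟙 : Bool → ℕ
𝟙 true  = 1
𝟙 false = 0

𝟙-≤ : ∀ b {y} → (T b → 1 ≤ y) → 𝟙 b ≤ y
𝟙-≤ true  b⇒1≤y = b⇒1≤y _
𝟙-≤ false _     = z≤n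

𝟙-true : ∀ b → T b → 1 ≤ 𝟙 b
𝟙-true true _ = ≤-refl

𝟙-pos : ∀ b → 0 < 𝟙 b → T b
𝟙-pos true _ = _

count : {A : Set} → (A → Bool) → List A → ℕ
count p []       = 0
count p (x ∷ xs) = 𝟙 (p x) + count p xs

length-filter≡count : {A : Set} {P : A → Set} (P? : Decidable P) (xs : List A) →
  length (filter P? xs) ≡ count (does ∘ P?) xs
length-filter≡count P? []       = refl
length-filter≡count P? (x ∷ xs) with does (P? x)
... | true  = cong suc (length-filter≡count P? xs)
... | false = length-filter≡count P? xs

count-++ : {A : Set} (p : A → Bool) (xs ys : List A) →
  count p (xs ++ ys) ≡ count p xs + count p ys
count-++ p []       ys = refl
count-++ p (x ∷ xs) ys = trans (cong (𝟙 (p x) +_) (count-++ p xs ys)) (sym (+-assoc (𝟙 (p x)) _ _))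

count-map : {A B : Set} (p : B → Bool) (g : A → B) (xs : List A) →
  count p (map g xs) ≡ count (p ∘ g) xs
count-map p g []       = refl
count-map p g (x ∷ xs) = cong (𝟙 (p (g x)) +_) (count-map p g xs)

count-mono : {A : Set} (p q : A → Bool) → (∀ x → T (p x) → T (q x)) →
  (xs : List A) → count p xs ≤ count q xs
count-mono p q p⇒q []       = z≤n
count-mono p q p⇒q (x ∷ xs) =
  +-mono-≤ (𝟙-≤ (p x) (𝟙-true (q x) ∘ p⇒q x)) (count-mono p q p⇒q xs)

count-tabulate : {A : Set} (p : A → Bool) {n : ℕ} (g : Fin n → A) →
  count p (tabulate g) ≡ ∑[ i < n ] 𝟙 (p (g i))
count-tabulate p {zero}  g = refl
count-tabulate p {suc n} g = cong (𝟙 (p (g Fin.zero)) +_) (count-tabulate p (g ∘ Fin.suc))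

count-concatMap : {A B : Set} (p : B → Bool) (h : A → List B) {n : ℕ} (g : Fin n → A) →
  count p (concatMap h (tabulate g)) ≡ ∑[ i < n ] count p (h (g i))
count-concatMap p h {zero}  g = refl
count-concatMap p h {suc n} g =
  trans (count-++ p (h (g Fin.zero)) _) (cong (count p (h (g Fin.zero)) +_) (count-concatMap p h (g ∘ Fin.suc)))

listSum-tabulate : {n : ℕ} (f : Fin n → ℕ) → List.sum (tabulate f) ≡ ∑[ i < n ] f i
listSum-tabulate {zero}  f = refl
listSum-tabulate {suc n} f = cong (f Fin.zero +_) (listSum-tabulate (f ∘ Fin.suc))

∑-mono-≤ : {n : ℕ} (f g : Fin n → ℕ) → (∀ i → f i ≤ g i) → ∑[ i < n ] f i ≤ ∑[ i < n ] g i
∑-mono-≤ {zero}  f g f≤g = z≤n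
∑-mono-≤ {suc n} f g f≤g = +-mono-≤ (f≤g Fin.zero) (∑-mono-≤ (f ∘ Fin.suc) (g ∘ Fin.suc) (f≤g ∘ Fin.suc))

term≤∑ : {n : ℕ} (f : Fin n → ℕ) (i : Fin n) → f i ≤ ∑[ j < n ] f j
term≤∑ f Fin.zero    = m≤m+n _ _
term≤∑ f (Fin.suc i) = ≤-trans (term≤∑ (f ∘ Fin.suc) i) (m≤n+m _ _)

∑-zero : {n : ℕ} (f : Fin n → ℕ) → (∀ j → f j ≡ 0) → ∑[ j < n ] f j ≡ 0
∑-zero {zero}  f _   = refl
∑-zero {suc n} f f≡0 = cong₂ _+_ (f≡0 Fin.zero) (∑-zero (f ∘ Fin.suc) (f≡0 ∘ Fin.suc))

∑-single : {n : ℕ} (f : Fin n → ℕ) (i : Fin n) → (∀ j → j ≢ i → f j ≡ 0) →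
  ∑[ j < n ] f j ≡ f i
∑-single {suc n} f Fin.zero    others =
  trans (cong (f Fin.zero +_) (∑-zero (f ∘ Fin.suc) (λ j → others (Fin.suc j) (λ ()))))
        (+-identityʳ _)
∑-single {suc n} f (Fin.suc i) others =
  cong₂ _+_ (others Fin.zero (λ ()))
            (∑-single (f ∘ Fin.suc) i (λ j j≢i → others (Fin.suc j) (j≢i ∘ Fin-suc-injective)))

∑-≥-length : {n : ℕ} (f : Fin n → ℕ) → (∀ i → 1 ≤ f i) → n ≤ ∑[ i < n ] f i
∑-≥-length {zero}  f _    = z≤n
∑-≥-length {suc n} f 1≤f = +-mono-≤ (1≤f Fin.zero) (∑-≥-length (f ∘ Fin.suc) (1≤f ∘ Fin.suc))

∑-ones : (n : ℕ) → ∑[ i < n ] 1 ≡ n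
∑-ones zero    = refl
∑-ones (suc n) = cong suc (∑-ones n)

≯0⇒≡0 : ∀ {x} → ¬ 0 < x → x ≡ 0
≯0⇒≡0 x≯0 = n≤0⇒n≡0 (≮⇒≥ x≯0)

∑-pos : {n : ℕ} (f : Fin n → ℕ) → 0 < ∑[ i < n ] f i → ∃ λ i → 0 < f i
∑-pos {suc n} f pos with 0 <? f Fin.zero
... | yes f₀-pos = Fin.zero , f₀-pos
... | no  f₀≯0   = shift (∑-pos (f ∘ Fin.suc) (subst (0 <_) drop-f₀ pos))
  where
  drop-f₀ : f Fin.zero + ∑[ i < n ] f (Fin.suc i) ≡ ∑[ i < n ] f (Fin.suc i)
  drop-f₀ = cong (_+ ∑[ i < n ] f (Fin.suc i)) (≯0⇒≡0 f₀≯0)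
  shift : (∃ λ i → 0 < f (Fin.suc i)) → ∃ λ i → 0 < f i
  shift (i , fᵢ-pos) = Fin.suc i , fᵢ-pos

hit-below : (K x : ℕ) → x < K → 1 ≤ ∑[ c < K ] 𝟙 (does (x ≟ toℕ c))
hit-below K x x<K = ≤-trans (𝟙-true _ x≡c₀) (term≤∑ (λ c → 𝟙 (does (x ≟ toℕ c))) c₀)
  where
  c₀ : Fin K
  c₀ = fromℕ< x<K
  x≡c₀ : T (does (x ≟ toℕ c₀))
  x≡c₀ = witness-yes (x ≟ toℕ c₀) (sym (toℕ-fromℕ< x<K))

∑-prefix : (n m : ℕ) → m ≤ n → ∑[ j < n ] 𝟙 (toℕ j <ᵇ m) ≡ m
∑-prefix zero    zero    z≤n       = refl
∑-prefix (suc n) zero    _         = ∑-prefix n zero z≤n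
∑-prefix (suc n) (suc m) (s≤s m≤n) = cong suc (∑-prefix n m m≤n)

⌈_/2⌉ : ℕ → ℕ
⌈ zero /2⌉          = 0
⌈ suc zero /2⌉      = 1
⌈ suc (suc x) /2⌉   = suc ⌈ x /2⌉

ceilHalf≡⌈/2⌉ : ∀ x → ceilHalf x ≡ ⌈ x /2⌉
ceilHalf≡⌈/2⌉ zero          = refl
ceilHalf≡⌈/2⌉ (suc zero)    = refl
ceilHalf≡⌈/2⌉ (suc (suc x)) =
  trans (m/n≡1+[m∸n]/n {suc (suc x) + 1} {2} (s≤s (s≤s z≤n))) (cong suc (ceilHalf≡⌈/2⌉ x))

⌈/2⌉-pos : ∀ x → 1 ≤ x → 1 ≤ ⌈ x /2⌉
⌈/2⌉-pos (suc zero)    _ = ≤-refl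
⌈/2⌉-pos (suc (suc x)) _ = s≤s z≤n

⌈/2⌉-mono : ∀ {x y} → x ≤ y → ⌈ x /2⌉ ≤ ⌈ y /2⌉
⌈/2⌉-mono {zero}                        _                 = z≤n
⌈/2⌉-mono {suc zero}    {suc y}         _                 = ⌈/2⌉-pos (suc y) (s≤s z≤n)
⌈/2⌉-mono {suc (suc x)} {suc (suc y)}  (s≤s (s≤s x≤y))   = s≤s (⌈/2⌉-mono x≤y)

⌈/2⌉-+ : ∀ x y → ⌈ x + y /2⌉ ≤ ⌈ x /2⌉ + ⌈ y /2⌉
⌈/2⌉-+ zero          y = ≤-refl
⌈/2⌉-+ (suc zero)    y = ⌈suc/2⌉ y
  where
  ⌈suc/2⌉ : ∀ y → ⌈ suc y /2⌉ ≤ suc ⌈ y /2⌉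
  ⌈suc/2⌉ zero          = ≤-refl
  ⌈suc/2⌉ (suc zero)    = s≤s z≤n
  ⌈suc/2⌉ (suc (suc y)) = s≤s (⌈suc/2⌉ y)
⌈/2⌉-+ (suc (suc x)) y = s≤s (⌈/2⌉-+ x y)

⌈/2⌉-∑ : {n : ℕ} (f : Fin n → ℕ) → ⌈ ∑[ i < n ] f i /2⌉ ≤ ∑[ i < n ] ⌈ f i /2⌉
⌈/2⌉-∑ {zero}  f = z≤n
⌈/2⌉-∑ {suc n} f =
  ≤-trans (⌈/2⌉-+ (f Fin.zero) _) (+-monoʳ-≤ ⌈ f Fin.zero /2⌉ (⌈/2⌉-∑ (f ∘ Fin.suc)))

⌈odd/2⌉ : ∀ d → ⌈ suc (2 * d) /2⌉ ≡ suc d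
⌈odd/2⌉ zero    = refl
⌈odd/2⌉ (suc d) = trans (cong ⌈_/2⌉ (2+2d d)) (cong suc (⌈odd/2⌉ d))
  where
  2+2d : ∀ d → suc (2 * suc d) ≡ suc (suc (suc (2 * d)))
  2+2d = solve-∀

-- If ⌈x/2⌉ ≥ d + 1 then x ≥ 2d + 1, since 2⌈x/2⌉ ≤ x + 1.
odd≤ : ∀ d x → suc d ≤ ⌈ x /2⌉ → suc (2 * d) ≤ x
odd≤ d x d<⌈x/2⌉ = ≤-pred (subst (_≤ suc x) (2*suc d) (≤-trans (*-monoʳ-≤ 2 d<⌈x/2⌉) (2⌈x/2⌉≤1+x x)))
  where
  2*suc : ∀ y → 2 * suc y ≡ suc (suc (2 * y))
  2*suc = solve-∀
  2⌈x/2⌉≤1+x : ∀ x → 2 * ⌈ x /2⌉ ≤ suc x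
  2⌈x/2⌉≤1+x zero          = z≤n
  2⌈x/2⌉≤1+x (suc zero)    = ≤-refl
  2⌈x/2⌉≤1+x (suc (suc x)) = subst (_≤ 3 + x) (sym (2*suc ⌈ x /2⌉)) (s≤s (s≤s (2⌈x/2⌉≤1+x x)))

∑⌈/2⌉-concentrated : {n : ℕ} (u : Fin n → ℕ) →
  (∀ i j → 0 < u i → 0 < u j → i ≡ j) → (∀ i → u i ≤ 2) → ∑[ i < n ] ⌈ u i /2⌉ ≤ 1
∑⌈/2⌉-concentrated u one-part u≤2 with any? (λ i → 0 <? u i)
... | no  none         =
  ≤-trans (≤-reflexive (∑-zero (λ j → ⌈ u j /2⌉) (λ j → cong ⌈_/2⌉ (≯0⇒≡0 (λ uⱼ-pos → none (j , uⱼ-pos)))))) z≤n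
... | yes (i , uᵢ-pos) = ≤-trans (≤-reflexive (∑-single (λ j → ⌈ u j /2⌉) i others)) (⌈/2⌉-mono (u≤2 i))
  where
  others : ∀ j → j ≢ i → ⌈ u j /2⌉ ≡ 0
  others j j≢i with 0 <? u j
  ... | yes uⱼ-pos = ⊥-elim (j≢i (one-part j i uⱼ-pos uᵢ-pos))
  ... | no  uⱼ≯0   = cong ⌈_/2⌉ (≯0⇒≡0 uⱼ≯0)

ceilDiv-≤ : ∀ x k q → x ≤ q * k → ceilDiv x k ≤ q
ceilDiv-≤ x zero    q _       = z≤n
ceilDiv-≤ x (suc k) q x≤qk = ≤-pred (m<n*o⇒m/o<n {x + k} {suc q} {suc k} x+k<[1+q]k)
  where
  x+k<[1+q]k : x + k < suc q * suc k
  x+k<[1+q]k = begin-strict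
      x + k               <⟨ +-monoʳ-< x (n<1+n k) ⟩
      x + suc k           ≤⟨ +-monoˡ-≤ (suc k) x≤qk ⟩
      q * suc k + suc k   ≡⟨ +-comm (q * suc k) (suc k) ⟩
      suc q * suc k       ∎
    where open ≤-Reasoning

floorDiv≤ceilDiv : ∀ x k → floorDiv x k ≤ ceilDiv x k
floorDiv≤ceilDiv x zero    = z≤n
floorDiv≤ceilDiv x (suc k) = /-monoˡ-≤ (suc k) (m≤m+n x k)

share≤ : ∀ {x k y} q → x ≤ q * k → y ≡ floorDiv x k ⊎ y ≡ ceilDiv x k → y ≤ q
share≤ {x} {k} q x≤qk (inj₁ refl) = ≤-trans (floorDiv≤ceilDiv x k) (ceilDiv-≤ x k q x≤qk)
share≤ {x} {k} q x≤qk (inj₂ refl) = ceilDiv-≤ x k q x≤qk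

¬choosable-0 : (G : Graph) → Vertex G → ¬ ProportionallyChoosable G 0
¬choosable-0 G v choosable with choosable (λ _ → []) (λ _ → [] , refl)
... | f , (f∈L , _) , _ with f∈L v
...   | ()

-- Sizes mᵢ ≤ nᵢ of the parts' "A-prefixes", with Σᵢ ⌈mᵢ/2⌉ = R and the economy
-- bound Σᵢ mᵢ + min(R, t) ≤ 2R (each used part is odd, and at least min(R, t)
-- parts are used).
record PartSizes (t : ℕ) (n : Fin t → ℕ) (R : ℕ) : Set where
  field
    size    : Fin t → ℕ
    size≤n  : ∀ i → size i ≤ n i
    halves  : ∑[ i < t ] ⌈ size i /2⌉ ≡ R
    economy : ∑[ i < t ] size i + R ⊓ t ≤ 2 * R

noParts : (t : ℕ) (n : Fin t → ℕ) → PartSizes t n 0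
noParts t n = record
  { size    = λ _ → 0
  ; size≤n  = λ _ → z≤n
  ; halves  = ∑-zero {t} (λ _ → 0) (λ _ → refl)
  ; economy = ≤-reflexive (trans (+-identityʳ _) (∑-zero {t} (λ _ → 0) (λ _ → refl)))
  }

consOne : {t R : ℕ} {n : Fin (suc t) → ℕ} → 1 ≤ n Fin.zero →
  PartSizes t (n ∘ Fin.suc) R → PartSizes (suc t) n (suc R)
consOne {t} {R} {n} 1≤n₀ P = record
  { size    = size′
  ; size≤n  = size′≤n
  ; halves  = cong suc (PartSizes.halves P)
  ; economy = economy′
  }
  where
  size′ : Fin (suc t) → ℕ
  size′ Fin.zero    = 1
  size′ (Fin.suc i) = PartSizes.size P i
  size′≤n : ∀ i → size′ i ≤ n i
  size′≤n Fin.zero    = 1≤n₀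
  size′≤n (Fin.suc i) = PartSizes.size≤n P i
  economy′ : suc (∑[ i < t ] PartSizes.size P i + suc (R ⊓ t)) ≤ 2 * suc R
  economy′ rewrite *-suc 2 R | +-suc (∑[ i < t ] PartSizes.size P i) (R ⊓ t) =
    s≤s (s≤s (PartSizes.economy P))

consOdd : {t s : ℕ} {n : Fin (suc t) → ℕ} (d : ℕ) → suc d ≤ ⌈ n Fin.zero /2⌉ → t ≤ s →
  PartSizes t (n ∘ Fin.suc) s → PartSizes (suc t) n (suc (d + s))
consOdd {t} {s} {n} d d<⌈n₀/2⌉ t≤s P = record
  { size    = size′
  ; size≤n  = size′≤n
  ; halves  = trans (cong (_+ ∑[ i < t ] ⌈ m i /2⌉) (⌈odd/2⌉ d)) (cong (suc d +_) (PartSizes.halves P))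
  ; economy = economy′
  }
  where
  m : Fin t → ℕ
  m = PartSizes.size P
  size′ : Fin (suc t) → ℕ
  size′ Fin.zero    = suc (2 * d)
  size′ (Fin.suc i) = m i
  size′≤n : ∀ i → size′ i ≤ n i
  size′≤n Fin.zero    = odd≤ d (n Fin.zero) d<⌈n₀/2⌉
  size′≤n (Fin.suc i) = PartSizes.size≤n P i
  rearrange : ∀ a b c → suc (2 * a) + b + suc c ≡ 2 + (2 * a + (b + c))
  rearrange = solve-∀
  expand : ∀ a b → 2 * suc (a + b) ≡ 2 + (2 * a + 2 * b)
  expand = solve-∀
  economy′ : suc (2 * d) + ∑[ i < t ] m i + suc ((d + s) ⊓ t) ≤ 2 * suc (d + s)
  economy′ = begin
      suc (2 * d) + ∑[ i < t ] m i + suc ((d + s) ⊓ t)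
    ≡⟨ cong (λ z → suc (2 * d) + ∑[ i < t ] m i + suc z) (m≥n⇒m⊓n≡n (≤-trans t≤s (m≤n+m s d))) ⟩
      suc (2 * d) + ∑[ i < t ] m i + suc t
    ≡⟨ rearrange d (∑[ i < t ] m i) t ⟩
      2 + (2 * d + (∑[ i < t ] m i + t))
    ≤⟨ +-monoʳ-≤ 2 (+-monoʳ-≤ (2 * d) (subst (λ z → ∑[ i < t ] m i + z ≤ 2 * s) (m≥n⇒m⊓n≡n t≤s) (PartSizes.economy P))) ⟩
      2 + (2 * d + 2 * s)
    ≡⟨ expand d s ⟨
      2 * suc (d + s) ∎
    where open ≤-Reasoning

-- Every R ≤ Σᵢ ⌈nᵢ/2⌉ is realised: fill the first part with a single vertex
-- while the remaining parts can still carry R − 1, otherwise give it an odd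
-- number of vertices and saturate the remaining parts.
partSizes : (t : ℕ) (n : Fin t → ℕ) → (∀ i → 1 ≤ n i) →
  (R : ℕ) → R ≤ ∑[ i < t ] ⌈ n i /2⌉ → PartSizes t n R
partSizes t       n pos zero    _       = noParts t n
partSizes (suc t) n pos (suc R) R<∑ with R ≤? s
  where s = ∑[ i < t ] ⌈ n (Fin.suc i) /2⌉
... | yes R≤s = consOne (pos Fin.zero) (partSizes t (n ∘ Fin.suc) (pos ∘ Fin.suc) R R≤s)
... | no  R≰s = subst (PartSizes (suc t) n) (cong suc (m∸n+n≡m s≤R))
                  (consOdd (R ∸ s) d<⌈n₀/2⌉ t≤s (partSizes t (n ∘ Fin.suc) (pos ∘ Fin.suc) s ≤-refl))
  where
  s = ∑[ i < t ] ⌈ n (Fin.suc i) /2⌉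
  s≤R : s ≤ R
  s≤R = <⇒≤ (≰⇒> R≰s)
  t≤s : t ≤ s
  t≤s = ∑-≥-length (λ i → ⌈ n (Fin.suc i) /2⌉) (λ i → ⌈/2⌉-pos _ (pos (Fin.suc i)))
  d<⌈n₀/2⌉ : suc (R ∸ s) ≤ ⌈ n Fin.zero /2⌉
  d<⌈n₀/2⌉ = +-cancelʳ-≤ s _ _ (subst (_≤ ⌈ n Fin.zero /2⌉ + s) (cong suc (sym (m∸n+n≡m s≤R))) R<∑)

count-vertices : (t : ℕ) (n : Fin t → ℕ) (p : Vertex (completeMultipartite t n) → Bool) →
  count p (vertices (completeMultipartite t n)) ≡ ∑[ i < t ] ∑[ j < n i ] 𝟙 (p (i , j))
count-vertices t n p =
  trans (count-concatMap p part (λ i → i))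
        (sum-cong-≗ (λ i → trans (count-map p (i ,_) (allFin (n i))) (count-tabulate (p ∘ (i ,_)) (λ j → j))))
  where
  part : Fin t → List (Vertex (completeMultipartite t n))
  part i = map (i ,_) (allFin (n i))

module Counterexample (t : ℕ) (n : Fin t → ℕ) (k : ℕ) (m : Fin t → ℕ)
  (m≤n : ∀ i → m i ≤ n i) (∑m≤2K : ∑[ i < t ] m i ≤ 2 * suc k)
  (K<∑⌈m/2⌉ : suc k < ∑[ i < t ] ⌈ m i /2⌉) where

  K : ℕ
  K = suc k

  G : Graph
  G = completeMultipartite t n

  inPrefix : Vertex G → Bool
  inPrefix (i , j) = toℕ j <ᵇ m i

  colours : Bool → List Colour
  colours true  = upTo K
  colours false = map (K +_) (upTo K)

  L : ListAssignment G
  L v = colours (inPrefix v)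

  L-is-K-assignment : IsKAssignment G K L
  L-is-K-assignment v = K-colours (inPrefix v)
    where
    K-colours : ∀ b → Unique (colours b) × length (colours b) ≡ K
    K-colours true  = Unique.upTo⁺ K , length-upTo K
    K-colours false = Unique.map⁺ (+-cancelˡ-≡ K _ _) (Unique.upTo⁺ K) ,
                      trans (length-map (K +_) (upTo K)) (length-upTo K)

  prefix⇒low : ∀ b c → c ∈ colours b → T b → c < K
  prefix⇒low true c c∈ _ = ∈-upTo⁻ c∈

  low⇒prefix : ∀ b c → c ∈ colours b → c < K → T b
  low⇒prefix true  c _  _ = _
  low⇒prefix false c c∈ c<K with ∈-map⁻ (K +_) c∈
  ... | x , _ , refl = ⊥-elim (<⇒≱ c<K (m≤m+n K x))

  η-low : ∀ c → c < K → η G L c ≤ 2 * K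
  η-low c c<K = begin
      η G L c
    ≡⟨ length-filter≡count (λ v → c ∈? L v) (vertices G) ⟩
      count (λ v → does (c ∈? L v)) (vertices G)
    ≤⟨ count-mono _ inPrefix (λ v c∈Lv → low⇒prefix (inPrefix v) c (yes-witness (c ∈? L v) c∈Lv) c<K) (vertices G) ⟩
      count inPrefix (vertices G)
    ≡⟨ count-vertices t n inPrefix ⟩
      ∑[ i < t ] ∑[ j < n i ] 𝟙 (toℕ j <ᵇ m i)
    ≡⟨ sum-cong-≗ (λ i → ∑-prefix (n i) (m i) (m≤n i)) ⟩
      ∑[ i < t ] m i
    ≤⟨ ∑m≤2K ⟩
      2 * K ∎
    where open ≤-Reasoning

  module Colouring (f : Vertex G → Colour) (f-proportional : IsProportionalLColouring G K L f) where

    f∈L : ∀ v → f v ∈ L v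
    f∈L = proj₁ (proj₁ f-proportional)

    uses : Fin t → Colour → ℕ
    uses i c = ∑[ j < n i ] 𝟙 (does (f (i , j) ≟ c))

    preimage≡∑uses : ∀ c → preimageSize G f c ≡ ∑[ i < t ] uses i c
    preimage≡∑uses c = trans (length-filter≡count (λ v → f v ≟ c) (vertices G))
                             (count-vertices t n (λ v → does (f v ≟ c)))

    used-at : ∀ i c → 0 < uses i c → ∃ λ j → f (i , j) ≡ c
    used-at i c pos with ∑-pos (λ j → 𝟙 (does (f (i , j) ≟ c))) pos
    ... | j , hit = j , yes-witness (f (i , j) ≟ c) (𝟙-pos _ hit)

    one-part : ∀ c i i′ → 0 < uses i c → 0 < uses i′ c → i ≡ i′
    one-part c i i′ used used′ with i Fin.≟ i′ | used-at i c used | used-at i′ c used′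
    ... | yes i≡i′ | _ | _ = i≡i′
    ... | no  i≢i′ | j , fij≡c | j′ , fi′j′≡c =
      ⊥-elim (proj₂ (proj₁ f-proportional) (i , j) (i′ , j′) i≢i′ (trans fij≡c (sym fi′j′≡c)))

    uses≤2 : ∀ c → c < K → ∀ i → uses i c ≤ 2
    uses≤2 c c<K i with 0 <? uses i c
    ... | no  unused = ≤-trans (≤-reflexive (≯0⇒≡0 unused)) z≤n
    ... | yes used   with used-at i c used
    ...   | j , fij≡c = begin
        uses i c                   ≤⟨ term≤∑ (λ i′ → uses i′ c) i ⟩
        ∑[ i′ < t ] uses i′ c      ≡⟨ preimage≡∑uses c ⟨
        preimageSize G f c         ≤⟨ share≤ 2 (η-low c c<K) (proj₂ f-proportional c in-palette) ⟩
        2                          ∎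
      where
      open ≤-Reasoning
      in-palette : InPalette G L c
      in-palette = (i , j) , subst (_∈ L (i , j)) fij≡c (f∈L (i , j))

    prefix-covered : ∀ i → m i ≤ ∑[ c < K ] uses i (toℕ c)
    prefix-covered i = begin
        m i
      ≡⟨ ∑-prefix (n i) (m i) (m≤n i) ⟨
        ∑[ j < n i ] 𝟙 (toℕ j <ᵇ m i)
      ≤⟨ ∑-mono-≤ _ _ (λ j → 𝟙-≤ (toℕ j <ᵇ m i) (λ in-prefix →
           hit-below K (f (i , j)) (prefix⇒low _ _ (f∈L (i , j)) in-prefix))) ⟩
        ∑[ j < n i ] ∑[ c < K ] 𝟙 (does (f (i , j) ≟ toℕ c))
      ≡⟨ ∑-comm {n i} {K} (λ j c → 𝟙 (does (f (i , j) ≟ toℕ c))) ⟩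
        ∑[ c < K ] uses i (toℕ c) ∎
      where open ≤-Reasoning

    ∑⌈m/2⌉≤K : ∑[ i < t ] ⌈ m i /2⌉ ≤ K
    ∑⌈m/2⌉≤K = begin
        ∑[ i < t ] ⌈ m i /2⌉
      ≤⟨ ∑-mono-≤ _ _ (λ i → ⌈/2⌉-mono (prefix-covered i)) ⟩
        ∑[ i < t ] ⌈ ∑[ c < K ] uses i (toℕ c) /2⌉
      ≤⟨ ∑-mono-≤ _ _ (λ i → ⌈/2⌉-∑ {K} (λ c → uses i (toℕ c))) ⟩
        ∑[ i < t ] ∑[ c < K ] ⌈ uses i (toℕ c) /2⌉
      ≡⟨ ∑-comm {t} {K} (λ i c → ⌈ uses i (toℕ c) /2⌉) ⟩
        ∑[ c < K ] ∑[ i < t ] ⌈ uses i (toℕ c) /2⌉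
      ≤⟨ ∑-mono-≤ _ _ (λ c → ∑⌈/2⌉-concentrated (λ i → uses i (toℕ c))
                              (one-part (toℕ c)) (uses≤2 (toℕ c) (toℕ<n c))) ⟩
        ∑[ c < K ] 1
      ≡⟨ ∑-ones K ⟩
        K ∎
      where open ≤-Reasoning

  not-choosable : ¬ ProportionallyChoosable G K
  not-choosable choosable with choosable L L-is-K-assignment
  ... | f , f-proportional = <⇒≱ K<∑⌈m/2⌉ (Colouring.∑⌈m/2⌉≤K f f-proportional)

-- For k ≥ 1 take part sizes with Σ ⌈mᵢ/2⌉ = k + 1; since at
-- least min(k + 1, t) ≥ 2 parts are used, Σ mᵢ ≤ 2(k + 1) − 2 = 2k.
not-choosable-below : (t : ℕ) → 2 ≤ t → (n : Fin t → ℕ) → (∀ i → 1 ≤ n i) →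
  ∀ k → k < ∑[ i < t ] ⌈ n i /2⌉ → ¬ ProportionallyChoosable (completeMultipartite t n) k
not-choosable-below t 2≤t n pos zero    _   = ¬choosable-0 (completeMultipartite t n) (i₀ , fromℕ< (pos i₀))
  where
  i₀ : Fin t
  i₀ = fromℕ< 2≤t
not-choosable-below t 2≤t n pos (suc k) k<s =
  Counterexample.not-choosable t n k size size≤n ∑m≤2K (≤-reflexive (sym halves))
  where
  open PartSizes (partSizes t n pos (suc (suc k)) k<s)
  2≤parts : 2 ≤ suc (suc k) ⊓ t
  2≤parts = ⊓-glb (s≤s (s≤s z≤n)) 2≤t
  ∑m≤2K : ∑[ i < t ] size i ≤ 2 * suc k
  ∑m≤2K = +-cancelʳ-≤ 2 _ _ (begin
      ∑[ i < t ] size i + 2                  ≤⟨ +-monoʳ-≤ (∑[ i < t ] size i) 2≤parts ⟩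
      ∑[ i < t ] size i + suc (suc k) ⊓ t    ≤⟨ economy ⟩
      2 * suc (suc k)                        ≡⟨ *-suc 2 (suc k) ⟩
      2 + 2 * suc k                          ≡⟨ +-comm 2 (2 * suc k) ⟩
      2 * suc k + 2                          ∎)
    where open ≤-Reasoning

theorem7 : (t : ℕ) → 2 ≤ t → (n : Fin t → ℕ) → (∀ i → 1 ≤ n i) →
    ¬ ProportionallyChoosable (completeMultipartite t n) (sumCeilHalves t n ∸ 1)
    × (∀ k → ProportionallyChoosable (completeMultipartite t n) k → sumCeilHalves t n ≤ k)
theorem7 t 2≤t n pos =
    not-choosable (s ∸ 1) (∸-monoʳ-< {s} {1} {0} (s≤s z≤n) 1≤s)
  , λ k choosable → ≮⇒≥ (λ k<s → not-choosable k k<s choosable)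
  where
  s : ℕ
  s = sumCeilHalves t n
  s≡∑⌈n/2⌉ : s ≡ ∑[ i < t ] ⌈ n i /2⌉
  s≡∑⌈n/2⌉ = trans (listSum-tabulate (λ i → ceilHalf (n i))) (sum-cong-≗ (λ i → ceilHalf≡⌈/2⌉ (n i)))
  not-choosable : ∀ k → k < s → ¬ ProportionallyChoosable (completeMultipartite t n) k
  not-choosable k k<s = not-choosable-below t 2≤t n pos k (subst (k <_) s≡∑⌈n/2⌉ k<s)
  1≤s : 1 ≤ s
  1≤s = subst (1 ≤_) (sym s≡∑⌈n/2⌉)
          (≤-trans (≤-trans (s≤s z≤n) 2≤t) (∑-≥-length (λ i → ⌈ n i /2⌉) (λ i → ⌈/2⌉-pos (n i) (pos i))))
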